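{- Let $\mathcal{M}=(E,\mathcal{I})$ be a matroid with $\#E=n$ and rank $r(E)=k$, with dual matroid $\mathcal{M}^*$. Then for every $j\in\{1,\dots,n\}$, $$k_{n-j}(\mathcal{M}^*)=k_j(\mathcal{M})+n-j-k.$$ Moreover, if $k_j(\mathcal{M})=h^0(\mathcal{M},J)$ for some $J\subset E$ with $\#J=j$, then $k_{n-j}(\mathcal{M}^*)=h^0(\mathcal{M}^*,E\setminus J)$.
   Context: The matroid rank function is $r(J)=\max\{\#I:I\in\mathcal{I},I\subset J\}$; $\mathcal{M}^*$ has bases the complements of bases of $\mathcal{M}$, rank function $r^*$. For a matroid $\mathcal{N}$ on $E$ with rank function $\rho$, $h^0(\mathcal{N},J)=\rho(E)-\rho(E\setminus J)$, and the dimension/length profile is $k_j(\mathcal{N})=\max\{h^0(\mathcal{N},J): J\subset E,\ \#J=j\}$ for $0\le j\le n$. -}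

module Defs where

open import Data.Bool using (Bool; true; false; _∧_; not)
open import Data.Nat using (ℕ; zero; suc; _∸_; _⊔_; _<_)
open import Data.Fin using (Fin)
open import Data.Fin.Subset using (Subset; ⊥; ⁅_⁆; _∪_; _∩_; ∁; _⊆_; _∈_; _∉_; ∣_∣)
open import Data.Fin.Subset.Properties using (_⊆?_; _∈?_)
open import Data.List using (List; []; _∷_; map; _++_; filterᵇ; foldr; allFin)
open import Data.Bool.ListAction using (all; any)
open import Data.Vec using (Vec; []; _∷_)
open import Data.Product using (Σ; _×_; _,_)
open import Relation.Binary.PropositionalEquality using (_≡_)
open import Relation.Nullary.Decidable using (⌊_⌋)

allSubsets : (n : ℕ) → List (Subset n)
allSubsets zero    = [] ∷ []
allSubsets (suc n) = map (true ∷_) (allSubsets n) ++ map (false ∷_) (allSubsets n)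

maxList : List ℕ → ℕ
maxList = foldr _⊔_ 0

record Matroid (n : ℕ) : Set where
  field
    indep       : Subset n → Bool
    indep-empty : indep ⊥ ≡ true
    indep-down  : ∀ {I J : Subset n} → I ⊆ J → indep J ≡ true → indep I ≡ true
    indep-aug   : ∀ {I J : Subset n} → indep I ≡ true → indep J ≡ true → ∣ I ∣ < ∣ J ∣ →
                  Σ (Fin n) (λ x → x ∈ J × x ∉ I × indep (I ∪ ⁅ x ⁆) ≡ true)
open Matroid public

rankOf : {n : ℕ} → (Subset n → Bool) → Subset n → ℕ
rankOf {n} ind J =
  maxList (map ∣_∣ (filterᵇ (λ I → ind I ∧ ⌊ I ⊆? J ⌋) (allSubsets n)))

rank : {n : ℕ} → Matroid n → Subset n → ℕ
rank M = rankOf (indep M)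

isBasis : {n : ℕ} → Matroid n → Subset n → Bool
isBasis {n} M B =
  indep M B ∧ all (λ x → ⌊ x ∈? B ⌋ ∨' not (indep M (B ∪ ⁅ x ⁆))) (allFin n)
  where
  _∨'_ : Bool → Bool → Bool
  true  ∨' _ = true
  false ∨' b = b

-- Independent sets of the dual matroid M*: the subsets of complements of bases
-- of M (the bases of M* are exactly the complements E ∖ B of bases B of M).
dualIndep : {n : ℕ} → Matroid n → Subset n → Bool
dualIndep {n} M I = any (λ B → isBasis M B ∧ ⌊ I ⊆? ∁ B ⌋) (allSubsets n)

dualRank : {n : ℕ} → Matroid n → Subset n → ℕ
dualRank M = rankOf (dualIndep M)

h0 : {n : ℕ} → (Subset n → ℕ) → Subset n → ℕ
h0 {n} ρ J = ρ (∁ ⊥) ∸ ρ (∁ J)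

kprof : {n : ℕ} → (Subset n → ℕ) → ℕ → ℕ
kprof {n} ρ j = maxList (map (h0 ρ) (filterᵇ (λ J → ⌊ ∣ J ∣ Data.Nat.≟ j ⌋) (allSubsets n)))

-- The dual rank satisfies r*(X) + r(E) = #X + r(E ∖ X): a maximal independent subset of
-- E ∖ X extends to a basis B, and X ∖ B is co-independent; conversely a co-independent
-- D ⊆ X avoids some basis B, and B ∖ X is independent inside E ∖ X. With X = E and X = J
-- this gives h⁰(M*, E ∖ J) + r(E) = h⁰(M, J) + #(E ∖ J), and J ↦ E ∖ J is a bijection
-- between the j-subsets and the (n − j)-subsets, so the maxima correspond, the one for M*
-- being attained at E ∖ J whenever the one for M is attained at J.
module Submission where

open import Defs
open import Data.Bool using (Bool; true; false; T; T?; _∧_)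
open import Data.Bool.ListAction using (all)
open import Data.Bool.Properties using (T-≡; T-∧; T-not-≡)
open import Data.Fin using (Fin)
open import Data.Fin.Subset using (Subset; ⊥; ⁅_⁆; _∪_; _∩_; ∁; _⊆_; _∉_; ∣_∣; inside; outside)
open import Data.Fin.Subset.Properties
  using ( _⊆?_; _∈?_; ∉⊥; ⊥⊆; x∉p⇒x∈∁p; x∈p∩q⁺; p∩q⊆p; p∩q⊆q; p⊆p∪q; p⊆q⇒∣p∣≤∣q∣
        ; ∣⊥∣≡0; ∣p∣≤n; ∣∁p∣≡n∸∣p∣; ∪-identityʳ; drop-not-there)
open import Data.List using ([]; _∷_; map; filterᵇ; allFin)
import Data.List.Relation.Unary.Any as Any
open import Data.List.Relation.Unary.Any.Properties using (any⁺; any⁻)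
open import Data.List.Relation.Unary.All using (lookup)
open import Data.List.Relation.Unary.All.Properties using (all⁺; all⁻; ¬All⇒Any¬)
open import Data.List.Membership.Propositional using (lose) renaming (_∈_ to _∈ˡ_)
open import Data.List.Membership.Propositional.Properties
  using (∈-++⁺ˡ; ∈-++⁺ʳ; ∈-map⁺; ∈-map∘filter⁺; ∈-map∘filter⁻; ∈-allFin)
open import Data.Nat using (ℕ; zero; suc; _+_; _∸_; _≤_; _<_; _≟_; _≤?_; s≤s)
open import Data.Nat.Properties
open import Data.Product using (_×_; _,_; proj₁; proj₂; ∃-syntax; Σ-syntax)
open import Data.Sum using (inj₁; inj₂)
open import Data.Vec using ([]; _∷_; here)
open import Function using (_∘_; id)
open import Function.Bundles using (Equivalence)
open import Relation.Binary.PropositionalEquality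
open import Relation.Nullary using (yes; no; ¬_; contradiction)
open import Relation.Nullary.Decidable using (⌊_⌋; toWitness; fromWitness)

open Equivalence using (to; from)

private
  variable
    n : ℕ

maxList-upper : ∀ {x xs} → x ∈ˡ xs → x ≤ maxList xs
maxList-upper {xs = y ∷ ys} (Any.here refl) = m≤m⊔n y (maxList ys)
maxList-upper {xs = y ∷ ys} (Any.there x∈ys) = ≤-trans (maxList-upper x∈ys) (m≤n⊔m y (maxList ys))

maxList-∈∷ : ∀ y ys → maxList (y ∷ ys) ∈ˡ y ∷ ys
maxList-∈∷ y [] = Any.here (⊔-identityʳ y)
maxList-∈∷ y (z ∷ zs) with ⊔-sel y (maxList (z ∷ zs)) | maxList-∈∷ z zs
... | inj₁ y⊔m≡y | _ = Any.here y⊔m≡y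
... | inj₂ y⊔m≡m | m∈ = Any.there (subst (_∈ˡ z ∷ zs) (sym y⊔m≡m) m∈)

maxList-∈ : ∀ {x xs} → x ∈ˡ xs → maxList xs ∈ˡ xs
maxList-∈ {xs = y ∷ ys} _ = maxList-∈∷ y ys

∈-allSubsets : (S : Subset n) → S ∈ˡ allSubsets n
∈-allSubsets [] = Any.here refl
∈-allSubsets {suc n} (inside ∷ S) = ∈-++⁺ˡ (∈-map⁺ (inside ∷_) (∈-allSubsets S))
∈-allSubsets {suc n} (outside ∷ S) =
  ∈-++⁺ʳ (map (inside ∷_) (allSubsets n)) (∈-map⁺ (outside ∷_) (∈-allSubsets S))

-- The maximum of f over the subsets satisfying p; both rankOf and kprof unfold to it.
maxOver : (Subset n → ℕ) → (Subset n → Bool) → ℕ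
maxOver {n} f p = maxList (map f (filterᵇ p (allSubsets n)))

module _ (f : Subset n → ℕ) (p : Subset n → Bool) where

  private
    value∈ : ∀ {S} → T (p S) → f S ∈ˡ map f (filterᵇ p (allSubsets n))
    value∈ {S} pS = ∈-map∘filter⁺ f (T? ∘ p) (S , ∈-allSubsets S , refl , pS)

  maxOver-upper : ∀ S → T (p S) → f S ≤ maxOver f p
  maxOver-upper _ = maxList-upper ∘ value∈

  maxOver-attained : ∀ S → T (p S) → ∃[ S′ ] T (p S′) × maxOver f p ≡ f S′
  maxOver-attained _ pS with ∈-map∘filter⁻ f (T? ∘ p) {xs = allSubsets n} (maxList-∈ (value∈ pS))
  ... | S′ , _ , max≡fS′ , pS′ = S′ , pS′ , max≡fS′

module _ {p : Fin n → Bool} where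

  all-allFin⁻ : T (all p (allFin n)) → ∀ x → T (p x)
  all-allFin⁻ all-p x = lookup (all⁺ p (allFin n) all-p) (∈-allFin x)

  ¬all-allFin⁻ : ¬ T (all p (allFin n)) → ∃[ x ] ¬ T (p x)
  ¬all-allFin⁻ ¬all-p = Any.satisfied (¬All⇒Any¬ (T? ∘ p) (allFin n) (¬all-p ∘ all⁻ p))

∁-involutive : (p : Subset n) → ∁ (∁ p) ≡ p
∁-involutive [] = refl
∁-involutive (inside ∷ p) = cong (inside ∷_) (∁-involutive p)
∁-involutive (outside ∷ p) = cong (outside ∷_) (∁-involutive p)

⊆-∩ : {p q r : Subset n} → p ⊆ q → p ⊆ r → p ⊆ q ∩ r
⊆-∩ p⊆q p⊆r x∈p = x∈p∩q⁺ (p⊆q x∈p , p⊆r x∈p)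

⊆∁⊥ : (p : Subset n) → p ⊆ ∁ ⊥
⊆∁⊥ _ _ = x∉p⇒x∈∁p ∉⊥

x∉p⇒∣p∪⁅x⁆∣≡1+∣p∣ : {x : Fin n} {p : Subset n} → x ∉ p → ∣ p ∪ ⁅ x ⁆ ∣ ≡ suc ∣ p ∣
x∉p⇒∣p∪⁅x⁆∣≡1+∣p∣ {x = Fin.zero} {inside ∷ p} x∉p = contradiction here x∉p
x∉p⇒∣p∪⁅x⁆∣≡1+∣p∣ {x = Fin.zero} {outside ∷ p} _ = cong (suc ∘ ∣_∣) (∪-identityʳ p)
x∉p⇒∣p∪⁅x⁆∣≡1+∣p∣ {x = Fin.suc x} {inside ∷ p} x∉p =
  cong suc (x∉p⇒∣p∪⁅x⁆∣≡1+∣p∣ (drop-not-there x∉p))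
x∉p⇒∣p∪⁅x⁆∣≡1+∣p∣ {x = Fin.suc x} {outside ∷ p} x∉p = x∉p⇒∣p∪⁅x⁆∣≡1+∣p∣ (drop-not-there x∉p)

∣p∩∁q∣+∣q∣≡∣p∣+∣q∩∁p∣ : (p q : Subset n) → ∣ p ∩ ∁ q ∣ + ∣ q ∣ ≡ ∣ p ∣ + ∣ q ∩ ∁ p ∣
∣p∩∁q∣+∣q∣≡∣p∣+∣q∩∁p∣ [] [] = refl
∣p∩∁q∣+∣q∣≡∣p∣+∣q∩∁p∣ (inside ∷ p) (inside ∷ q) =
  trans (+-suc _ _) (cong suc (∣p∩∁q∣+∣q∣≡∣p∣+∣q∩∁p∣ p q))
∣p∩∁q∣+∣q∣≡∣p∣+∣q∩∁p∣ (inside ∷ p) (outside ∷ q) = cong suc (∣p∩∁q∣+∣q∣≡∣p∣+∣q∩∁p∣ p q)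
∣p∩∁q∣+∣q∣≡∣p∣+∣q∩∁p∣ (outside ∷ p) (inside ∷ q) =
  trans (+-suc _ _) (trans (cong suc (∣p∩∁q∣+∣q∣≡∣p∣+∣q∩∁p∣ p q)) (sym (+-suc _ _)))
∣p∩∁q∣+∣q∣≡∣p∣+∣q∩∁p∣ (outside ∷ p) (outside ∷ q) = ∣p∩∁q∣+∣q∣≡∣p∣+∣q∩∁p∣ p q

∣p∣≡j⇒∣∁p∣≡n∸j : ∀ {j} (p : Subset n) → ∣ p ∣ ≡ j → ∣ ∁ p ∣ ≡ n ∸ j
∣p∣≡j⇒∣∁p∣≡n∸j {n} p ∣p∣≡j = trans (∣∁p∣≡n∸∣p∣ p) (cong (n ∸_) ∣p∣≡j)

∣p∣+∣∁p∣≡n : (p : Subset n) → ∣ p ∣ + ∣ ∁ p ∣ ≡ n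
∣p∣+∣∁p∣≡n p = trans (cong (∣ p ∣ +_) (∣∁p∣≡n∸∣p∣ p)) (m+[n∸m]≡n (∣p∣≤n p))

subset-of-size : ∀ {j} → j ≤ n → Σ[ S ∈ Subset n ] ∣ S ∣ ≡ j
subset-of-size {n} {zero} _ = ⊥ , ∣⊥∣≡0 n
subset-of-size {suc n} {suc j} (s≤s j≤n) with subset-of-size j≤n
... | S , ∣S∣≡j = inside ∷ S , cong suc ∣S∣≡j

hasSize : ℕ → Subset n → Bool
hasSize j S = ⌊ ∣ S ∣ ≟ j ⌋

hasSize⁺ : ∀ {j} (S : Subset n) → ∣ S ∣ ≡ j → T (hasSize j S)
hasSize⁺ {j = j} S = fromWitness {a? = ∣ S ∣ ≟ j}

hasSize⁻ : ∀ {j} (S : Subset n) → T (hasSize j S) → ∣ S ∣ ≡ j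
hasSize⁻ {j = j} S = toWitness {a? = ∣ S ∣ ≟ j}

maxOver-hasSize-∁ : (f g : Subset n → ℕ) {c d j : ℕ} → j ≤ n →
                    (∀ J → ∣ J ∣ ≡ j → g (∁ J) + c ≡ f J + d) →
                    maxOver g (hasSize (n ∸ j)) + c ≡ maxOver f (hasSize j) + d
maxOver-hasSize-∁ {n} f g {c} {d} {j} j≤n g∁≡f = ≤-antisym g-side≤f-side f-side≤g-side
  where
  open ≤-Reasoning

  ∁-size : ∀ J → ∣ J ∣ ≡ j → T (hasSize (n ∸ j) (∁ J))
  ∁-size J ∣J∣≡j = hasSize⁺ (∁ J) (∣p∣≡j⇒∣∁p∣≡n∸j J ∣J∣≡j)

  ∁-size′ : ∀ K → T (hasSize (n ∸ j) K) → ∣ ∁ K ∣ ≡ j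
  ∁-size′ K K-size = trans (∣p∣≡j⇒∣∁p∣≡n∸j K (hasSize⁻ K K-size)) (m∸[m∸n]≡n j≤n)

  S : Subset n
  S = proj₁ (subset-of-size j≤n)

  ∣S∣≡j : ∣ S ∣ ≡ j
  ∣S∣≡j = proj₂ (subset-of-size j≤n)

  g-side≤f-side : maxOver g (hasSize (n ∸ j)) + c ≤ maxOver f (hasSize j) + d
  g-side≤f-side with maxOver-attained g (hasSize (n ∸ j)) (∁ S) (∁-size S ∣S∣≡j)
  ... | K , K-size , max≡gK = begin
    maxOver g (hasSize (n ∸ j)) + c ≡⟨ cong (_+ c) max≡gK ⟩
    g K + c                         ≡⟨ cong (λ K → g K + c) (∁-involutive K) ⟨
    g (∁ (∁ K)) + c                 ≡⟨ g∁≡f (∁ K) ∣∁K∣≡j ⟩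
    f (∁ K) + d                     ≤⟨ +-monoˡ-≤ d (maxOver-upper f (hasSize j) (∁ K) (hasSize⁺ (∁ K) ∣∁K∣≡j)) ⟩
    maxOver f (hasSize j) + d       ∎
    where
    ∣∁K∣≡j : ∣ ∁ K ∣ ≡ j
    ∣∁K∣≡j = ∁-size′ K K-size

  f-side≤g-side : maxOver f (hasSize j) + d ≤ maxOver g (hasSize (n ∸ j)) + c
  f-side≤g-side with maxOver-attained f (hasSize j) S (hasSize⁺ S ∣S∣≡j)
  ... | J , J-size , max≡fJ = begin
    maxOver f (hasSize j) + d       ≡⟨ cong (_+ d) max≡fJ ⟩
    f J + d                         ≡⟨ g∁≡f J ∣J∣≡j ⟨
    g (∁ J) + c                     ≤⟨ +-monoˡ-≤ c (maxOver-upper g (hasSize (n ∸ j)) (∁ J) (∁-size J ∣J∣≡j)) ⟩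
    maxOver g (hasSize (n ∸ j)) + c ∎
    where
    ∣J∣≡j : ∣ J ∣ ≡ j
    ∣J∣≡j = hasSize⁻ J J-size

module _ (ind : Subset n → Bool) where

  private
    admissible : ∀ {I J} → T (ind I) → I ⊆ J → T (ind I ∧ ⌊ I ⊆? J ⌋)
    admissible {I} {J} indI I⊆J = from T-∧ (indI , fromWitness {a? = I ⊆? J} I⊆J)

  rankOf-upper : ∀ {I J} → T (ind I) → I ⊆ J → ∣ I ∣ ≤ rankOf ind J
  rankOf-upper {J = J} indI I⊆J = maxOver-upper ∣_∣ (λ I → ind I ∧ ⌊ I ⊆? J ⌋) _ (admissible indI I⊆J)

  rankOf-attained : ∀ {I J} → T (ind I) → I ⊆ J →
                    ∃[ I′ ] T (ind I′) × I′ ⊆ J × ∣ I′ ∣ ≡ rankOf ind J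
  rankOf-attained {J = J} indI I⊆J
    with maxOver-attained ∣_∣ (λ I → ind I ∧ ⌊ I ⊆? J ⌋) _ (admissible indI I⊆J)
  ... | I′ , admI′ , rank≡∣I′∣ with to T-∧ admI′
  ...   | indI′ , I′⊆J = I′ , indI′ , toWitness I′⊆J , sym rank≡∣I′∣

∸-complement-identity : ∀ {a b c k m m′} → a + k ≡ m + m′ → b + k ≡ m + c → c ≤ k → c ≤ m′ →
                        (a ∸ b) + k ≡ (k ∸ c) + m′
∸-complement-identity {a} {b} {c} {k} {m} {m′} a+k≡m+m′ b+k≡m+c c≤k c≤m′ = begin
  (a ∸ b) + k       ≡⟨ cong (λ t → t ∸ b + k) a≡b+e ⟩
  (b + e ∸ b) + k   ≡⟨ cong (_+ k) (m+n∸m≡n b e) ⟩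
  e + k             ≡⟨ +-comm e k ⟩
  k + e             ≡⟨ cong (_+ e) (m∸n+n≡m c≤k) ⟨
  (k ∸ c + c) + e   ≡⟨ +-assoc (k ∸ c) c e ⟩
  (k ∸ c) + (c + e) ≡⟨ cong (k ∸ c +_) (m+[n∸m]≡n c≤m′) ⟩
  (k ∸ c) + m′      ∎
  where
  open ≡-Reasoning
  e : ℕ
  e = m′ ∸ c
  a≡b+e : a ≡ b + e
  a≡b+e = +-cancelʳ-≡ k a (b + e) (begin
    a + k           ≡⟨ a+k≡m+m′ ⟩
    m + m′          ≡⟨ cong (m +_) (m+[n∸m]≡n c≤m′) ⟨
    m + (c + e)     ≡⟨ +-assoc m c e ⟨
    (m + c) + e     ≡⟨ cong (_+ e) b+k≡m+c ⟨
    (b + k) + e     ≡⟨ +-assoc b k e ⟩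
    b + (k + e)     ≡⟨ cong (b +_) (+-comm k e) ⟩
    b + (e + k)     ≡⟨ +-assoc b e k ⟨
    (b + e) + k     ∎)

module _ (M : Matroid n) where

  fullRank : ℕ
  fullRank = rank M (∁ ⊥)

  rank-upper : ∀ {I J} → indep M I ≡ true → I ⊆ J → ∣ I ∣ ≤ rank M J
  rank-upper indI = rankOf-upper (indep M) (from T-≡ indI)

  rank-attained : ∀ J → ∃[ I ] indep M I ≡ true × I ⊆ J × ∣ I ∣ ≡ rank M J
  rank-attained J with rankOf-attained (indep M) (from T-≡ (indep-empty M)) ⊥⊆
  ... | I , indI , I⊆J , ∣I∣≡r = I , to T-≡ indI , I⊆J , ∣I∣≡r

  rank≤∣_∣ : ∀ J → rank M J ≤ ∣ J ∣
  rank≤∣ J ∣ with rank-attained J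
  ... | I , _ , I⊆J , ∣I∣≡r = subst (_≤ ∣ J ∣) ∣I∣≡r (p⊆q⇒∣p∣≤∣q∣ I⊆J)

  rank≤fullRank : ∀ J → rank M J ≤ fullRank
  rank≤fullRank J with rank-attained J
  ... | I , indI , _ , ∣I∣≡r = subst (_≤ fullRank) ∣I∣≡r (rank-upper indI (⊆∁⊥ I))

  rank-⊥ : rank M ⊥ ≡ 0
  rank-⊥ = n≤0⇒n≡0 (subst (rank M ⊥ ≤_) (∣⊥∣≡0 n) rank≤∣ ⊥ ∣)

  augment : ∀ {I} → indep M I ≡ true → ∣ I ∣ < fullRank →
            ∃[ x ] x ∉ I × indep M (I ∪ ⁅ x ⁆) ≡ true
  augment indI ∣I∣<r with rank-attained (∁ ⊥)
  ... | B , indB , _ , ∣B∣≡r with indep-aug M indI indB (subst (_ <_) (sym ∣B∣≡r) ∣I∣<r)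
  ...   | x , _ , x∉I , indI∪x = x , x∉I , indI∪x

  basis-indep : ∀ {B} → T (isBasis M B) → indep M B ≡ true
  basis-indep = to T-≡ ∘ proj₁ ∘ to T-∧

  basis-maximal : ∀ {B x} → T (isBasis M B) → x ∉ B → indep M (B ∪ ⁅ x ⁆) ≡ false
  -- Naming the first conjunct is what lets the `with` on x ∈? B abstract inside the result.
  basis-maximal {B} {x} isB x∉B with all-allFin⁻ (proj₂ (to (T-∧ {indep M B}) isB)) x
  ... | maximal-at-x with x ∈? B
  ...   | yes x∈B = contradiction x∈B x∉B
  ...   | no _ = to T-not-≡ maximal-at-x

  fullRank≤∣basis∣ : ∀ {B} → T (isBasis M B) → fullRank ≤ ∣ B ∣
  fullRank≤∣basis∣ {B} isB with fullRank ≤? ∣ B ∣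
  ... | yes r≤∣B∣ = r≤∣B∣
  ... | no r≰∣B∣ with augment (basis-indep isB) (≰⇒> r≰∣B∣)
  ...   | x , x∉B , indB∪x = contradiction (trans (sym indB∪x) (basis-maximal isB x∉B)) λ ()

  indep⇒basis : ∀ {B} → indep M B ≡ true → ∣ B ∣ ≡ fullRank → T (isBasis M B)
  indep⇒basis {B} indB ∣B∣≡r with T? (isBasis M B)
  ... | yes isB = isB
  ... | no ¬isB with ¬all-allFin⁻ (¬isB ∘ from (T-∧ {indep M B}) ∘ (from T-≡ indB ,_))
  ...   | x , ¬maximal-at-x with x ∈? B
  ...     | yes _ = contradiction _ ¬maximal-at-x
  ...     | no x∉B with indep M (B ∪ ⁅ x ⁆) in indB∪x
  ...       | false = contradiction _ ¬maximal-at-x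
  ...       | true = contradiction ∣B∣<r (<-irrefl ∣B∣≡r)
    where
    ∣B∣<r : ∣ B ∣ < fullRank
    ∣B∣<r = subst (_≤ fullRank) (x∉p⇒∣p∪⁅x⁆∣≡1+∣p∣ x∉B) (rank-upper indB∪x (⊆∁⊥ _))

  extend-to-basis : ∀ {I} → indep M I ≡ true → ∃[ B ] T (isBasis M B) × I ⊆ B × ∣ B ∣ ≡ fullRank
  extend-to-basis {I} indI = grow (fullRank ∸ ∣ I ∣) indI (m∸n+n≡m (rank-upper indI (⊆∁⊥ I)))
    where
    grow : ∀ d {I} → indep M I ≡ true → d + ∣ I ∣ ≡ fullRank →
           ∃[ B ] T (isBasis M B) × I ⊆ B × ∣ B ∣ ≡ fullRank
    grow zero indI ∣I∣≡r = _ , indep⇒basis indI ∣I∣≡r , id , ∣I∣≡r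
    grow (suc d) {I} indI d+1+∣I∣≡r with augment indI (subst (∣ I ∣ <_) d+1+∣I∣≡r (s≤s (m≤n+m ∣ I ∣ d)))
    ... | x , x∉I , indI∪x
        with grow d indI∪x (trans (cong (d +_) (x∉p⇒∣p∪⁅x⁆∣≡1+∣p∣ x∉I)) (trans (+-suc d ∣ I ∣) d+1+∣I∣≡r))
    ...   | B , isB , I∪x⊆B , ∣B∣≡r = B , isB , I∪x⊆B ∘ p⊆p∪q ⁅ x ⁆ , ∣B∣≡r

  basis-complement-dualIndep : ∀ {B D} → T (isBasis M B) → D ⊆ ∁ B → T (dualIndep M D)
  basis-complement-dualIndep {B} {D} isB D⊆∁B =
    any⁺ _ (lose (∈-allSubsets B) (from T-∧ (isB , fromWitness {a? = D ⊆? ∁ B} D⊆∁B)))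

  dualIndep⇒⊆∁basis : ∀ {D} → T (dualIndep M D) → ∃[ B ] T (isBasis M B) × D ⊆ ∁ B
  dualIndep⇒⊆∁basis {D} dualD with Any.satisfied (any⁻ _ (allSubsets n) dualD)
  ... | B , isB∧D⊆∁B with to T-∧ isB∧D⊆∁B
  ...   | isB , D⊆∁B = B , isB , toWitness {a? = D ⊆? ∁ B} D⊆∁B

  dualRank-upper : ∀ {D X} → T (dualIndep M D) → D ⊆ X → ∣ D ∣ ≤ dualRank M X
  dualRank-upper = rankOf-upper (dualIndep M)

  dualRank-attained : ∀ X → ∃[ D ] T (dualIndep M D) × D ⊆ X × ∣ D ∣ ≡ dualRank M X
  dualRank-attained X with extend-to-basis (indep-empty M)
  ... | B , isB , _ = rankOf-attained (dualIndep M) (basis-complement-dualIndep isB ⊥⊆) ⊥⊆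

  ∣X∣+rank∁≤dualRank+fullRank : ∀ X → ∣ X ∣ + rank M (∁ X) ≤ dualRank M X + fullRank
  ∣X∣+rank∁≤dualRank+fullRank X with rank-attained (∁ X)
  ... | I , indI , I⊆∁X , ∣I∣≡r with extend-to-basis indI
  ...   | B , isB , I⊆B , ∣B∣≡r = begin
    ∣ X ∣ + rank M (∁ X)   ≡⟨ cong (∣ X ∣ +_) ∣I∣≡r ⟨
    ∣ X ∣ + ∣ I ∣          ≤⟨ +-monoʳ-≤ ∣ X ∣ (p⊆q⇒∣p∣≤∣q∣ (⊆-∩ I⊆B I⊆∁X)) ⟩
    ∣ X ∣ + ∣ B ∩ ∁ X ∣    ≡⟨ ∣p∩∁q∣+∣q∣≡∣p∣+∣q∩∁p∣ X B ⟨
    ∣ X ∩ ∁ B ∣ + ∣ B ∣    ≡⟨ cong (∣ X ∩ ∁ B ∣ +_) ∣B∣≡r ⟩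
    ∣ X ∩ ∁ B ∣ + fullRank ≤⟨ +-monoˡ-≤ fullRank X∩∁B≤dualRank ⟩
    dualRank M X + fullRank ∎
    where
    open ≤-Reasoning
    X∩∁B≤dualRank : ∣ X ∩ ∁ B ∣ ≤ dualRank M X
    X∩∁B≤dualRank = dualRank-upper (basis-complement-dualIndep isB (p∩q⊆q X (∁ B))) (p∩q⊆p X (∁ B))

  dualRank+fullRank≤∣X∣+rank∁ : ∀ X → dualRank M X + fullRank ≤ ∣ X ∣ + rank M (∁ X)
  dualRank+fullRank≤∣X∣+rank∁ X with dualRank-attained X
  ... | D , dualD , D⊆X , ∣D∣≡r* with dualIndep⇒⊆∁basis dualD
  ...   | B , isB , D⊆∁B = begin
    dualRank M X + fullRank ≡⟨ cong (_+ fullRank) ∣D∣≡r* ⟨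
    ∣ D ∣ + fullRank        ≤⟨ +-mono-≤ (p⊆q⇒∣p∣≤∣q∣ (⊆-∩ D⊆X D⊆∁B)) (fullRank≤∣basis∣ isB) ⟩
    ∣ X ∩ ∁ B ∣ + ∣ B ∣     ≡⟨ ∣p∩∁q∣+∣q∣≡∣p∣+∣q∩∁p∣ X B ⟩
    ∣ X ∣ + ∣ B ∩ ∁ X ∣     ≤⟨ +-monoʳ-≤ ∣ X ∣ B∩∁X≤rank ⟩
    ∣ X ∣ + rank M (∁ X)    ∎
    where
    open ≤-Reasoning
    B∩∁X≤rank : ∣ B ∩ ∁ X ∣ ≤ rank M (∁ X)
    B∩∁X≤rank = rank-upper (indep-down M (p∩q⊆p B (∁ X)) (basis-indep isB)) (p∩q⊆q B (∁ X))

  dualRank+fullRank : ∀ X → dualRank M X + fullRank ≡ ∣ X ∣ + rank M (∁ X)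
  dualRank+fullRank X = ≤-antisym (dualRank+fullRank≤∣X∣+rank∁ X) (∣X∣+rank∁≤dualRank+fullRank X)

  dualFullRank+fullRank≡n : dualRank M (∁ ⊥) + fullRank ≡ n
  dualFullRank+fullRank≡n = begin
    dualRank M (∁ ⊥) + fullRank       ≡⟨ dualRank+fullRank (∁ ⊥) ⟩
    ∣ ∁ (⊥ {n}) ∣ + rank M (∁ (∁ ⊥))  ≡⟨ cong₂ _+_ ∣∁⊥∣≡n (trans (cong (rank M) (∁-involutive ⊥)) rank-⊥) ⟩
    n + 0                             ≡⟨ +-identityʳ n ⟩
    n                                 ∎
    where
    open ≡-Reasoning
    ∣∁⊥∣≡n : ∣ ∁ (⊥ {n}) ∣ ≡ n
    ∣∁⊥∣≡n = trans (∣∁p∣≡n∸∣p∣ (⊥ {n})) (cong (n ∸_) (∣⊥∣≡0 n))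

  h0-dual-complement : ∀ J → h0 (dualRank M) (∁ J) + fullRank ≡ h0 (rank M) J + ∣ ∁ J ∣
  h0-dual-complement J = begin
    h0 (dualRank M) (∁ J) + fullRank
      ≡⟨ cong (λ Y → dualRank M (∁ ⊥) ∸ dualRank M Y + fullRank) (∁-involutive J) ⟩
    dualRank M (∁ ⊥) ∸ dualRank M J + fullRank
      ≡⟨ ∸-complement-identity E+r≡J+∁J (dualRank+fullRank J) (rank≤fullRank (∁ J)) rank≤∣ ∁ J ∣ ⟩
    h0 (rank M) J + ∣ ∁ J ∣
      ∎
    where
    open ≡-Reasoning
    E+r≡J+∁J : dualRank M (∁ ⊥) + fullRank ≡ ∣ J ∣ + ∣ ∁ J ∣
    E+r≡J+∁J = trans dualFullRank+fullRank≡n (sym (∣p∣+∣∁p∣≡n J))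

kprof-dual : (M : Matroid n) {j : ℕ} → j ≤ n →
             kprof (dualRank M) (n ∸ j) + fullRank M ≡ kprof (rank M) j + (n ∸ j)
kprof-dual M j≤n = maxOver-hasSize-∁ (h0 (rank M)) (h0 (dualRank M)) j≤n λ J ∣J∣≡j →
  trans (h0-dual-complement M J) (cong (h0 (rank M) J +_) (∣p∣≡j⇒∣∁p∣≡n∸j J ∣J∣≡j))

proposition3p15 : (n : ℕ) (M : Matroid n) (j : ℕ) → 1 ≤ j → j ≤ n →
    (kprof (dualRank M) (n ∸ j) + rank M (∁ ⊥) ≡ kprof (rank M) j + (n ∸ j))
    × ((J : Subset n) → ∣ J ∣ ≡ j → kprof (rank M) j ≡ h0 (rank M) J →
        kprof (dualRank M) (n ∸ j) ≡ h0 (dualRank M) (∁ J))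
proposition3p15 n M j _ j≤n = kprof-dual M j≤n , attained-at-complement
  where
  attained-at-complement : (J : Subset n) → ∣ J ∣ ≡ j → kprof (rank M) j ≡ h0 (rank M) J →
                           kprof (dualRank M) (n ∸ j) ≡ h0 (dualRank M) (∁ J)
  attained-at-complement J ∣J∣≡j kprof≡h0J = +-cancelʳ-≡ (fullRank M) _ _ (begin
    kprof (dualRank M) (n ∸ j) + fullRank M ≡⟨ kprof-dual M j≤n ⟩
    kprof (rank M) j + (n ∸ j)             ≡⟨ cong₂ _+_ kprof≡h0J (sym (∣p∣≡j⇒∣∁p∣≡n∸j J ∣J∣≡j)) ⟩
    h0 (rank M) J + ∣ ∁ J ∣                ≡⟨ h0-dual-complement M J ⟨
    h0 (dualRank M) (∁ J) + fullRank M     ∎)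
    where open ≡-Reasoning
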